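{- Let $t \geq 3$ and $\gamma \geq 1$ be integers, and let $H^t_\gamma$ be the graph with vertex set $\{a_1,\dots,a_{\gamma+1}\} \cup \{b_1,\dots,b_\gamma\} \cup \{c_{\ell,k} : \ell \in [\gamma], k \in [t-3]\}$ whose edges are as follows: for each $\ell \in [\gamma]$, all pairs within $K_\ell := \{a_\ell, a_{\ell+1}, b_\ell, c_{\ell,1},\dots,c_{\ell,t-3}\}$ are edges, except that the pair $\{b_\ell, a_{\ell+1}\}$ is not an edge when $\ell < \gamma$ and the pair $\{a_\ell, b_\ell\}$ is not an edge when $\ell > 1$; additionally, $\{b_\ell, b_{\ell+1}\}$ is an edge for every $\ell \in [\gamma-1]$. Then (1) $|V(H^t_\gamma)| = (t-1)\gamma + 1$; (2) $H^t_\gamma$ is $t$-critical; (3) $\operatorname{pw}(H^t_\gamma) = \operatorname{tw}(H^t_\gamma) = t - 1$.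
   Context: A graph $G$ is $t$-critical if $\chi(G) = t$ and $\chi(G - v) = t - 1$ for every $v \in V(G)$, where $\chi$ is the chromatic number. The graph $H^t_\gamma$ described is the graph obtained from $K_t$ by $\gamma - 1$ successive applications of Hajós' construction with a fresh copy of $K_t$ (for $t=3$ these are the odd cycles). $\operatorname{pw}$, $\operatorname{tw}$ denote pathwidth and treewidth; $[n] = \{1,\dots,n\}$. -}

module Defs where

open import Data.Nat using (ℕ; zero; suc; _≤_; _<_; _∸_)
open import Data.Fin using (Fin; toℕ; inject₁)
open import Data.List using (List; length)
open import Data.List.Membership.Propositional using (_∈_)
open import Data.Product using (Σ; Σ-syntax; ∃; ∃-syntax; _×_; proj₁)
open import Data.Sum using (_⊎_)
open import Relation.Nullary using (¬_)
open import Relation.Binary.PropositionalEquality using (_≡_; _≢_)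

Colourable : {V : Set} → (V → V → Set) → ℕ → Set
Colourable {V} E k = Σ (V → Fin k) λ f → ∀ u v → E u v → f u ≢ f v

ChromaticNumber : {V : Set} → (V → V → Set) → ℕ → Set
ChromaticNumber E k = Colourable E k × (∀ j → Colourable E j → k ≤ j)

DelVertex : {V : Set} → (V → V → Set) → (v : V) → Σ V (λ u → u ≢ v) → Σ V (λ u → u ≢ v) → Set
DelVertex E v x y = E (proj₁ x) (proj₁ y)

Critical : {V : Set} → (V → V → Set) → ℕ → Set
Critical {V} E t = ChromaticNumber E t × (∀ (v : V) → ChromaticNumber (DelVertex E v) (t ∸ 1))

-- path decomposition of width ≤ w (bags B₀,…,B_{m-1} in a line; a bag is a
-- list of vertices, its size is bounded by its length)
record PathDecomposition {V : Set} (E : V → V → Set) (w : ℕ) : Set where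
  field
    m         : ℕ
    bag       : Fin m → List V
    width     : ∀ i → length (bag i) ≤ suc w
    coverV    : ∀ v → ∃[ i ] v ∈ bag i
    coverE    : ∀ u v → E u v → ∃[ i ] (u ∈ bag i × v ∈ bag i)
    interval  : ∀ v (i j k : Fin m) → toℕ i ≤ toℕ j → toℕ j ≤ toℕ k →
                v ∈ bag i → v ∈ bag k → v ∈ bag j

Pathwidth : {V : Set} → (V → V → Set) → ℕ → Set
Pathwidth E k = PathDecomposition E k × (∀ j → PathDecomposition E j → k ≤ j)

data Walk {A : Set} (R : A → A → Set) (P : A → Set) : A → A → Set where
  [_]  : ∀ {x} → P x → Walk R P x x
  _∷_  : ∀ {x y z} → P x × R x y → Walk R P y z → Walk R P x z

-- A tree on nodes Fin (suc m), given as a rooted tree: node 0 is the root and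
-- node (suc i) has parent (par i), whose index is at most i.
TreeAdj : {m : ℕ} → (Fin m → Fin (suc m)) → Fin (suc m) → Fin (suc m) → Set
TreeAdj {m} par x y =
  ∃[ i ] ((x ≡ Fin.suc i × y ≡ par i) ⊎ (y ≡ Fin.suc i × x ≡ par i))

record TreeDecomposition {V : Set} (E : V → V → Set) (w : ℕ) : Set where
  field
    m         : ℕ
    par       : Fin m → Fin (suc m)
    par-lt    : ∀ i → toℕ (par i) ≤ toℕ i
    bag       : Fin (suc m) → List V
    width     : ∀ x → length (bag x) ≤ suc w
    coverV    : ∀ v → ∃[ x ] v ∈ bag x
    coverE    : ∀ u v → E u v → ∃[ x ] (u ∈ bag x × v ∈ bag x)
    connected : ∀ v x y → v ∈ bag x → v ∈ bag y →
                Walk (TreeAdj par) (λ z → v ∈ bag z) x y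

Treewidth : {V : Set} → (V → V → Set) → ℕ → Set
Treewidth E k = TreeDecomposition E k × (∀ j → TreeDecomposition E j → k ≤ j)

-- The graph H^t_γ (0-based indices: a_0..a_γ, b_0..b_{γ-1},
-- c_{ℓ,k} with ℓ < γ, k < t-3).

data HVertex (t γ : ℕ) : Set where
  a : Fin (suc γ) → HVertex t γ
  b : Fin γ → HVertex t γ
  c : Fin γ → Fin (t ∸ 3) → HVertex t γ

InK : {t γ : ℕ} → Fin γ → HVertex t γ → Set
InK ℓ (a i)   = (toℕ i ≡ toℕ ℓ) ⊎ (toℕ i ≡ suc (toℕ ℓ))
InK ℓ (b j)   = j ≡ ℓ
InK ℓ (c j k) = j ≡ ℓ

IsPair : {A : Set} → A → A → A → A → Set
IsPair x y u v = (u ≡ x × v ≡ y) ⊎ (u ≡ y × v ≡ x)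

Excluded : {t γ : ℕ} → Fin γ → HVertex t γ → HVertex t γ → Set
Excluded {t} {γ} ℓ u v =
  (suc (toℕ ℓ) < γ × IsPair (b ℓ) (a (Fin.suc ℓ)) u v)
  ⊎ (0 < toℕ ℓ × IsPair (a (inject₁ ℓ)) (b ℓ) u v)

HAdj : (t γ : ℕ) → HVertex t γ → HVertex t γ → Set
HAdj t γ u v =
  (Σ[ ℓ ∈ Fin γ ] (InK ℓ u × InK ℓ v × u ≢ v × ¬ Excluded ℓ u v))
  ⊎ (Σ[ ℓ ∈ Fin γ ] Σ[ ℓ' ∈ Fin γ ] (toℕ ℓ' ≡ suc (toℕ ℓ) × IsPair (b ℓ) (b ℓ') u v))

-- The vertices a_0 … a_γ, b_{γ−1} … b_0 form an odd cycle, and each K_ℓ is a t-set that is a clique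
-- up to its excluded pairs. A colouring with fewer than t colours repeats a colour in every K_ℓ, which
-- propagates along the chain of blocks to a contradiction, so χ(H) ≥ t; deleting any vertex cuts the
-- cycle (at b_ℓ if the vertex is c_{ℓ,k}), which is then 2-coloured while the c's keep their own
-- colours, so χ(H − v) ≤ t − 1. For the widths, consecutive blocks glued along three vertices give a
-- path decomposition of width t − 1, and since every vertex has t − 1 neighbours no tree
-- decomposition is narrower.

module Submission where

open import Defs
open import Data.Nat using (ℕ; _≤_; _+_; _*_; _∸_)
open import Data.Fin using (Fin)
open import Data.Product using (_×_)
open import Function.Bundles using (_↔_)

open import Data.Bool using (Bool; true; false; not)
open import Data.Bool.Properties using (not-¬)
open import Data.Empty using (⊥-elim)
open import Data.Fin using (zero; suc; toℕ; inject₁; fromℕ; fromℕ<) renaming (_≟_ to _≟ᶠ_)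
open import Data.Fin.Induction using (<-weakInduction)
open import Data.Fin.Properties
  using (toℕ-injective; toℕ-inject₁; toℕ-fromℕ; toℕ-fromℕ<; toℕ<n; inject₁-injective; fromℕ≢inject₁;
         injective⇒≤; inj⇒≟; pigeonhole; +↔⊎; *↔×)
  renaming (<⇒≢ to <⇒≢ᶠ)
open import Data.Fin.Relation.Unary.Top using (view; ‵fromℕ; ‵inject₁)
open import Data.List using (List; []; _∷_; length; lookup; map; allFin)
open import Data.List.Extrema.Nat using (argmax; f[xs]≤f[argmax])
open import Data.List.Properties using (length-map; length-tabulate)
open import Data.List.Membership.Propositional using (_∈_; _∉_)
open import Data.List.Membership.Propositional.Properties using (∈-map⁺; ∈-map⁻; ∈-allFin)
import Data.List.Membership.DecPropositional as DecMembership
import Data.List.Relation.Unary.All as All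
open import Data.List.Relation.Unary.Any using (here; there; index)
open import Data.List.Relation.Unary.Any.Properties using (lookup-index)
open import Data.Nat using (zero; suc; _<_; z≤n; s≤s; s≤s⁻¹; _<?_)
open import Data.Nat.DivMod using (_mod_; m<n⇒m%n≡m)
open import Data.Nat.Properties hiding (_≟_)
open import Data.Nat.Tactic.RingSolver using (solve-∀)
open import Data.Product using (Σ-syntax; ∃; _,_; proj₁; proj₂)
open import Data.Sum using (_⊎_; inj₁; inj₂; swap)
open import Data.Sum.Function.Propositional using (_⊎-↔_)
open import Function using (_∘_; id; case_of_)
open import Function.Bundles using (Inverse; mk↔ₛ′)
open import Function.Definitions using (Injective)
open import Function.Properties.Inverse using (↔-refl; ↔-sym; ↔-trans; ↔⇒↣)
open import Relation.Binary.Definitions using (DecidableEquality)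
open import Relation.Binary.PropositionalEquality
open import Relation.Nullary using (¬_; Dec; yes; no)
open import Relation.Nullary.Decidable using (_×-dec_; _⊎-dec_)
open import Relation.Unary using (Decidable)

extendColouring : ∀ {V : Set} {E : V → V → Set} → DecidableEquality V → (∀ {u} → ¬ E u u) →
                  ∀ {j} v → Colourable (DelVertex E v) j → Colourable E (suc j)
extendColouring {V} {E} _≟_ irrefl {j} v (f , f-proper) = colour , colour-proper
  where
  colour : V → Fin (suc j)
  colour u with u ≟ v
  ... | yes _   = fromℕ j
  ... | no u≢v  = inject₁ (f (u , u≢v))

  colour-proper : ∀ u w → E u w → colour u ≢ colour w
  colour-proper u w e with u ≟ v | w ≟ v
  ... | yes refl | yes refl = λ _ → irrefl e
  ... | yes refl | no _     = fromℕ≢inject₁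
  ... | no _     | yes refl = fromℕ≢inject₁ ∘ sym
  ... | no u≢v   | no w≢v   = f-proper (u , u≢v) (w , w≢v) e ∘ inject₁-injective

injective⇒≤-length : ∀ {A : Set} {n} (xs : List A) {f : Fin n → A} →
                     Injective _≡_ _≡_ f → (∀ i → f i ∈ xs) → n ≤ length xs
injective⇒≤-length xs {f} f-injective f∈xs = injective⇒≤ λ {i} {j} eq → f-injective (begin
  f i                          ≡⟨ lookup-index (f∈xs i) ⟩
  lookup xs (index (f∈xs i))   ≡⟨ cong (lookup xs) eq ⟩
  lookup xs (index (f∈xs j))   ≡⟨ lookup-index (f∈xs j) ⟨
  f j                          ∎)
  where open ≡-Reasoning

least : ∀ {n} {P : Fin n → Set} → Decidable P → ∃ P →
        Σ[ i ∈ Fin n ] P i × (∀ j → toℕ j < toℕ i → ¬ P j)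
least {zero}  _  (() , _)
least {suc n} P? witness with P? zero | witness
... | yes p0  | _       = zero , p0 , λ _ ()
... | no ¬p0  | zero , p0 = ⊥-elim (¬p0 p0)
... | no ¬p0  | suc i , pi with least (P? ∘ suc) (i , pi)
...   | k , pk , below = suc k , pk , λ { zero _ → ¬p0 ; (suc j) j<k → below j (s≤s⁻¹ j<k) }

-- Path and tree decompositions

module _ {A : Set} {R : A → A → Set} {P : A → Set} where

  walk-head : ∀ {x y} → Walk R P x y → P x
  walk-head [ p ]         = p
  walk-head ((p , _) ∷ _) = p

  walk-snoc : ∀ {x y z} → Walk R P x y → R y z → P z → Walk R P x z
  walk-snoc [ p ]            r q = (p , r) ∷ [ q ]
  walk-snoc ((p , r′) ∷ ps) r q = (p , r′) ∷ walk-snoc ps r q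

  walk-reverse : (∀ {x y} → R x y → R y x) → ∀ {x y} → Walk R P x y → Walk R P y x
  walk-reverse sym [ p ]           = [ p ]
  walk-reverse sym ((p , r) ∷ ps) = walk-snoc (walk-reverse sym ps) (sym r) p

TreeAdj-sym : ∀ {m} {par : Fin m → Fin (suc m)} {x y} → TreeAdj par x y → TreeAdj par y x
TreeAdj-sym (i , inj₁ edge) = i , inj₂ edge
TreeAdj-sym (i , inj₂ edge) = i , inj₁ edge

module _ {m} (P : Fin (suc m) → Set)
         (convex : ∀ i j k → toℕ i ≤ toℕ j → toℕ j ≤ toℕ k → P i → P k → P j) where

  ascendingWalk : ∀ x y → toℕ x ≤ toℕ y → P x → P y → Walk (TreeAdj inject₁) P x y
  ascendingWalk x = <-weakInduction (λ y → toℕ x ≤ toℕ y → P x → P y → Walk (TreeAdj inject₁) P x y)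
                                    base step
    where
    base : toℕ x ≤ 0 → P x → P zero → Walk (TreeAdj inject₁) P x zero
    base x≤0 px _ = subst (Walk _ P x) (toℕ-injective (n≤0⇒n≡0 x≤0)) [ px ]

    step : ∀ i → (toℕ x ≤ toℕ (inject₁ i) → P x → P (inject₁ i) → Walk (TreeAdj inject₁) P x (inject₁ i)) →
           toℕ x ≤ suc (toℕ i) → P x → P (suc i) → Walk (TreeAdj inject₁) P x (suc i)
    step i walk-to-i x≤1+i px p1+i with m≤n⇒m<n∨m≡n x≤1+i
    ... | inj₂ x≡1+i = subst (Walk _ P x) (toℕ-injective x≡1+i) [ px ]
    ... | inj₁ x<1+i = walk-snoc (walk-to-i x≤i px pi) (i , inj₂ (refl , refl)) p1+i
      where
      x≤i : toℕ x ≤ toℕ (inject₁ i)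
      x≤i = subst (toℕ x ≤_) (sym (toℕ-inject₁ i)) (s≤s⁻¹ x<1+i)
      pi : P (inject₁ i)
      pi = convex x (inject₁ i) (suc i) x≤i (≤-trans (≤-reflexive (toℕ-inject₁ i)) (n≤1+n _)) px p1+i

  pathWalk : ∀ x y → P x → P y → Walk (TreeAdj inject₁) P x y
  pathWalk x y px py with ≤-total (toℕ x) (toℕ y)
  ... | inj₁ x≤y = ascendingWalk x y x≤y px py
  ... | inj₂ y≤x = walk-reverse TreeAdj-sym (ascendingWalk y x y≤x py px)

pathDecomposition⇒treeDecomposition : ∀ {V : Set} {E : V → V → Set} {w} →
                                      V → PathDecomposition E w → TreeDecomposition E w
pathDecomposition⇒treeDecomposition v record { m = zero ; coverV = coverV } with () ← proj₁ (coverV v)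
pathDecomposition⇒treeDecomposition _ record
  { m = suc m ; bag = bag ; width = width ; coverV = coverV ; coverE = coverE ; interval = interval } = record
  { m = m ; par = inject₁ ; par-lt = ≤-reflexive ∘ toℕ-inject₁ ; bag = bag ; width = width
  ; coverV = coverV ; coverE = coverE
  ; connected = λ v → pathWalk (λ x → v ∈ bag x) (interval v) }

module RootedTree {m} (par : Fin m → Fin (suc m)) (par-lt : ∀ i → toℕ (par i) ≤ toℕ i) where

  data Descendant (ρ : Fin (suc m)) : Fin (suc m) → Set where
    here  : Descendant ρ ρ
    child : ∀ {i} → Descendant ρ (par i) → Descendant ρ (suc i)

  Descendant⇒≤ : ∀ {ρ x} → Descendant ρ x → toℕ ρ ≤ toℕ x
  Descendant⇒≤ here              = ≤-refl
  Descendant⇒≤ (child {i} ρ≤par) = ≤-trans (Descendant⇒≤ ρ≤par) (≤-trans (par-lt i) (n≤1+n _))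

  -- Leaving the subtree of ρ means stepping from ρ to its parent, below ρ.
  walk-stays-in-subtree : ∀ {P ρ x y} → Walk (TreeAdj par) P x y → (∀ z → P z → toℕ ρ ≤ toℕ z) →
                          Descendant ρ x → Descendant ρ y
  walk-stays-in-subtree [ _ ] _ d = d
  walk-stays-in-subtree ((_ , i , inj₁ (refl , refl)) ∷ ps) above here =
    ⊥-elim (<-irrefl refl (≤-<-trans (above _ (walk-head ps)) (s≤s (par-lt i))))
  walk-stays-in-subtree ((_ , i , inj₁ (refl , refl)) ∷ ps) above (child d) =
    walk-stays-in-subtree ps above d
  walk-stays-in-subtree ((_ , i , inj₂ (refl , refl)) ∷ ps) above d =
    walk-stays-in-subtree ps above (child d)

  walk-leaving-subtree-visits-root : ∀ {P ρ x y} → Walk (TreeAdj par) P x y → Descendant ρ x →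
                                     toℕ y ≤ toℕ ρ → P ρ
  walk-leaving-subtree-visits-root {P} [ p ] d y≤ρ =
    subst P (toℕ-injective (≤-antisym y≤ρ (Descendant⇒≤ d))) p
  walk-leaving-subtree-visits-root ((p , i , inj₁ (refl , refl)) ∷ _) here _ = p
  walk-leaving-subtree-visits-root ((_ , i , inj₁ (refl , refl)) ∷ ps) (child d) =
    walk-leaving-subtree-visits-root ps d
  walk-leaving-subtree-visits-root ((_ , i , inj₂ (refl , refl)) ∷ ps) d =
    walk-leaving-subtree-visits-root ps (child d)

IsPair-swap : ∀ {A : Set} {x y u w : A} → IsPair x y u w → IsPair x y w u
IsPair-swap (inj₁ (u≡x , w≡y)) = inj₂ (w≡y , u≡x)
IsPair-swap (inj₂ (u≡y , w≡x)) = inj₁ (w≡x , u≡y)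

IsPair-cong : ∀ {A B : Set} (f : A → B) {x y u w} → IsPair x y u w → f u ≡ f w → f x ≡ f y
IsPair-cong f (inj₁ (refl , refl)) eq = eq
IsPair-cong f (inj₂ (refl , refl)) eq = sym eq

IsPair-both : ∀ {A : Set} (P : A → Set) {x y u w} → IsPair x y u w → P x → P y → P u × P w
IsPair-both P (inj₁ (refl , refl)) px py = px , py
IsPair-both P (inj₂ (refl , refl)) px py = py , px

record ClosedNeighbours {V : Set} (E : V → V → Set) (v : V) (n : ℕ) : Set where
  field
    member    : Fin n → V
    injective : Injective _≡_ _≡_ member
    adjacent  : ∀ i → member i ≡ v ⊎ E v (member i)

-- Let r(v) be the first node whose bag contains v, and take v with r(v) last. The nodes whose bags
-- contain a neighbour u of v meet the subtree below r(v) and include r(u) ≤ r(v), hence include r(v).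
treeDecomposition-width-≥ : ∀ {V : Set} {E : V → V → Set} {N n w} → V ↔ Fin N → V →
                            (∀ v → ClosedNeighbours E v n) → TreeDecomposition E w → n ≤ suc w
treeDecomposition-width-≥ {V} {E} {N} finite v₀ neighbours td =
  ≤-trans (injective⇒≤-length (bag (root deepest)) injective (closedNeighbourhood⊆bag ∘ adjacent))
          (width (root deepest))
  where
  open TreeDecomposition td
  open RootedTree par par-lt
  open DecMembership (inj⇒≟ (↔⇒↣ finite)) using (_∈?_)

  rootOf : ∀ v → Σ[ x ∈ Fin (suc m) ] v ∈ bag x × (∀ y → toℕ y < toℕ x → v ∉ bag y)
  rootOf v = least (λ x → v ∈? bag x) (coverV v)

  root : V → Fin (suc m)
  root = proj₁ ∘ rootOf

  ∈bag-root : ∀ v → v ∈ bag (root v)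
  ∈bag-root = proj₁ ∘ proj₂ ∘ rootOf

  vertices : List V
  vertices = map (Inverse.from finite) (allFin N)

  ∈vertices : ∀ v → v ∈ vertices
  ∈vertices v = subst (_∈ vertices) (Inverse.strictlyInverseʳ finite v) (∈-map⁺ _ (∈-allFin _))

  deepest : V
  deepest = argmax (toℕ ∘ root) v₀ vertices

  root≤root-deepest : ∀ u → toℕ (root u) ≤ toℕ (root deepest)
  root≤root-deepest u = All.lookup (f[xs]≤f[argmax] v₀ vertices) (∈vertices u)

  subtree-deepest : ∀ x → deepest ∈ bag x → Descendant (root deepest) x
  subtree-deepest x d∈x =
    walk-stays-in-subtree (connected deepest (root deepest) x (∈bag-root deepest) d∈x)
                          (λ z d∈z → ≮⇒≥ λ z<root → proj₂ (proj₂ (rootOf deepest)) z z<root d∈z) here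

  closedNeighbourhood⊆bag : ∀ {u} → u ≡ deepest ⊎ E deepest u → u ∈ bag (root deepest)
  closedNeighbourhood⊆bag (inj₁ refl) = ∈bag-root deepest
  closedNeighbourhood⊆bag {u} (inj₂ e) with coverE deepest u e
  ... | x , d∈x , u∈x = walk-leaving-subtree-visits-root (connected u x (root u) u∈x (∈bag-root u))
                          (subtree-deepest x d∈x) (root≤root-deepest u)

  open ClosedNeighbours (neighbours deepest)

-- Colouring an odd cycle with one vertex removed

isEven : ℕ → Bool
isEven zero    = true
isEven (suc n) = not (isEven n)

isEven-double : ∀ n → isEven (n + n) ≡ true
isEven-double zero = refl
isEven-double (suc n) rewrite +-suc n n | isEven-double n = refl

-- Cutting the odd cycle 0, 1, …, n + n, 0 at position q leaves a path, which cutParity q 2-colours.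
cutParity : ℕ → ℕ → Bool
cutParity q p with p <? q
... | yes _ = isEven p
... | no _  = not (isEven p)

data CycleStep (n : ℕ) : ℕ → ℕ → Set where
  next : ∀ p → CycleStep n p (suc p)
  wrap : CycleStep n (n + n) 0

CycleStep-next : ∀ {n p p′} → p′ ≡ suc p → CycleStep n p p′
CycleStep-next refl = next _

cutParity-step : ∀ {n q p p′} → q ≤ n + n → q ≢ p′ → CycleStep n p p′ → cutParity q p ≢ cutParity q p′
cutParity-step {q = q} _ q≢1+p (next p) with p <? q | suc p <? q
... | yes _   | yes _     = not-¬ refl
... | yes p<q | no 1+p≮q = ⊥-elim (q≢1+p (≤-antisym (≮⇒≥ 1+p≮q) p<q))
... | no p≮q  | yes 1+p<q = ⊥-elim (p≮q (<-trans (n<1+n p) 1+p<q))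
... | no _    | no _      = not-¬ refl
cutParity-step {n} {q} q≤n+n q≢0 wrap with n + n <? q | 0 <? q
... | yes n+n<q | _      = ⊥-elim (<-irrefl refl (<-≤-trans n+n<q q≤n+n))
... | no _      | no 0≮q = ⊥-elim (q≢0 (n≤0⇒n≡0 (≮⇒≥ 0≮q)))
... | no _      | yes _  rewrite isEven-double n = λ ()

cutParity-proper : ∀ {n q p p′} → q ≤ n + n → q ≢ p → q ≢ p′ → CycleStep n p p′ ⊎ CycleStep n p′ p →
                   cutParity q p ≢ cutParity q p′
cutParity-proper q≤n+n _   q≢p′ (inj₁ step) = cutParity-step q≤n+n q≢p′ step
cutParity-proper q≤n+n q≢p _    (inj₂ step) = cutParity-step q≤n+n q≢p step ∘ sym

n≢2+n : ∀ n → n ≢ suc (suc n)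
n≢2+n n = <⇒≢ (m<n⇒m<1+n (n<1+n n))

double-suc : ∀ n → suc n + suc n ≡ 2 + (n + n)
double-suc n = cong suc (+-suc n n)

double-≤-suc-double⇒≤ : ∀ {x y} → x + x ≤ suc (y + y) → x ≤ y
double-≤-suc-double⇒≤ {x} {y} x+x≤ = ≮⇒≥ λ y<x →
  1+n≰n (≤-trans (≤-trans (≤-reflexive (sym (double-suc y))) (+-mono-≤ y<x y<x)) x+x≤)

double-≤-double⇒≤ : ∀ {x y} → x + x ≤ y + y → x ≤ y
double-≤-double⇒≤ x+x≤ = double-≤-suc-double⇒≤ (≤-trans x+x≤ (n≤1+n _))

suc-double≤double⇒< : ∀ {x y} → suc (y + y) ≤ x + x → y < x
suc-double≤double⇒< ≤x+x = ≰⇒> λ x≤y → 1+n≰n (≤-trans ≤x+x (+-mono-≤ x≤y x≤y))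

data Parity : ℕ → Set where
  even : ∀ n → Parity (n + n)
  odd  : ∀ n → Parity (suc (n + n))

parity : ∀ n → Parity n
parity zero = even 0
parity (suc n) with parity n
... | even k = odd k
... | odd k  = subst Parity (double-suc k) (even (suc k))

module H (s g : ℕ) where

  t γ : ℕ
  t = 3 + s
  γ = suc g

  V : Set
  V = HVertex t γ

  E : V → V → Set
  E = HAdj t γ

  vertices↔⊎ : V ↔ (Fin (suc γ) ⊎ (Fin γ ⊎ (Fin γ × Fin s)))
  vertices↔⊎ = mk↔ₛ′ to from to∘from from∘to
    where
    to : V → Fin (suc γ) ⊎ (Fin γ ⊎ (Fin γ × Fin s))
    to (a i)   = inj₁ i
    to (b j)   = inj₂ (inj₁ j)
    to (c j k) = inj₂ (inj₂ (j , k))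

    from : Fin (suc γ) ⊎ (Fin γ ⊎ (Fin γ × Fin s)) → V
    from (inj₁ i)              = a i
    from (inj₂ (inj₁ j))       = b j
    from (inj₂ (inj₂ (j , k))) = c j k

    to∘from : ∀ x → to (from x) ≡ x
    to∘from (inj₁ _)        = refl
    to∘from (inj₂ (inj₁ _)) = refl
    to∘from (inj₂ (inj₂ _)) = refl

    from∘to : ∀ v → from (to v) ≡ v
    from∘to (a _)   = refl
    from∘to (b _)   = refl
    from∘to (c _ _) = refl

  vertexCount : V ↔ Fin ((2 + s) * γ + 1)
  vertexCount = subst (λ n → V ↔ Fin n) (count γ s)
    (↔-trans vertices↔⊎ (↔-sym (↔-trans +↔⊎ (↔-refl ⊎-↔ ↔-trans +↔⊎ (↔-refl ⊎-↔ *↔×)))))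
    where
    count : ∀ x y → suc x + (x + x * y) ≡ (2 + y) * x + 1
    count = solve-∀

  _≟_ : DecidableEquality V
  _≟_ = inj⇒≟ (↔⇒↣ vertexCount)

  a-≢ : ∀ {i i′ : Fin (suc γ)} → toℕ i ≢ toℕ i′ → _≢_ {A = V} (a i) (a i′)
  a-≢ i≢i′ refl = i≢i′ refl

  Excluded-swap : ∀ {ℓ u w} → Excluded {t} {γ} ℓ u w → Excluded ℓ w u
  Excluded-swap (inj₁ (l , pair)) = inj₁ (l , IsPair-swap pair)
  Excluded-swap (inj₂ (l , pair)) = inj₂ (l , IsPair-swap pair)

  ¬Excluded-a-a : ∀ {ℓ x y} → ¬ Excluded {t} {γ} ℓ (a x) (a y)
  ¬Excluded-a-a (inj₁ (_ , inj₁ (() , _)))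
  ¬Excluded-a-a (inj₁ (_ , inj₂ (_ , ())))
  ¬Excluded-a-a (inj₂ (_ , inj₁ (_ , ())))
  ¬Excluded-a-a (inj₂ (_ , inj₂ (() , _)))

  ¬Excluded-c : ∀ {ℓ j k w} → ¬ Excluded {t} {γ} ℓ (c j k) w
  ¬Excluded-c (inj₁ (_ , inj₁ (() , _)))
  ¬Excluded-c (inj₁ (_ , inj₂ (() , _)))
  ¬Excluded-c (inj₂ (_ , inj₁ (() , _)))
  ¬Excluded-c (inj₂ (_ , inj₂ (() , _)))

  Excluded? : ∀ ℓ u w → Dec (Excluded {t} {γ} ℓ u w)
  Excluded? ℓ u w = (suc (toℕ ℓ) <? γ ×-dec IsPair? _ _) ⊎-dec (0 <? toℕ ℓ ×-dec IsPair? _ _)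
    where
    IsPair? : ∀ x y → Dec (IsPair x y u w)
    IsPair? x y = (u ≟ x ×-dec w ≟ y) ⊎-dec (u ≟ y ×-dec w ≟ x)

  E-sym : ∀ {u w} → E u w → E w u
  E-sym (inj₁ (ℓ , iu , iw , u≢w , ¬ex)) = inj₁ (ℓ , iw , iu , u≢w ∘ sym , ¬ex ∘ Excluded-swap)
  E-sym (inj₂ (ℓ , ℓ′ , ℓ′≡1+ℓ , pair)) = inj₂ (ℓ , ℓ′ , ℓ′≡1+ℓ , IsPair-swap pair)

  E-irrefl : ∀ {u} → ¬ E u u
  E-irrefl (inj₁ (_ , _ , _ , u≢u , _))                    = u≢u refl
  E-irrefl (inj₂ (_ , _ , ℓ′≡1+ℓ , inj₁ (refl , refl))) = 1+n≢n (sym ℓ′≡1+ℓ)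
  E-irrefl (inj₂ (_ , _ , ℓ′≡1+ℓ , inj₂ (refl , refl))) = 1+n≢n (sym ℓ′≡1+ℓ)

  adjacent-or-excluded : ∀ {ℓ u w} → InK ℓ u → InK ℓ w → u ≢ w → E u w ⊎ Excluded ℓ u w
  adjacent-or-excluded {ℓ} {u} {w} iu iw u≢w with Excluded? ℓ u w
  ... | yes ex = inj₂ ex
  ... | no ¬ex = inj₁ (inj₁ (ℓ , iu , iw , u≢w , ¬ex))

  b-chain-edge : ∀ (i : Fin g) → E (b (inject₁ i)) (b (suc i))
  b-chain-edge i = inj₂ (inject₁ i , suc i , cong suc (sym (toℕ-inject₁ i)) , inj₁ (refl , refl))

  data OnCycle : V → Set where
    cycle-a : ∀ i → OnCycle (a i)
    cycle-b : ∀ j → OnCycle (b j)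

  OnCycle⇒≢c : ∀ {v j k} → OnCycle v → v ≢ c j k
  OnCycle⇒≢c (cycle-a _) ()
  OnCycle⇒≢c (cycle-b _) ()

  tripleWithCs : V → V → V → Fin γ → Fin t → V
  tripleWithCs x y z ℓ zero                   = x
  tripleWithCs x y z ℓ (suc zero)             = y
  tripleWithCs x y z ℓ (suc (suc zero))       = z
  tripleWithCs x y z ℓ (suc (suc (suc k)))    = c ℓ k

  tripleWithCs-injective : ∀ {x y z ℓ} → OnCycle x → OnCycle y → OnCycle z → x ≢ y → x ≢ z → y ≢ z →
                           Injective _≡_ _≡_ (tripleWithCs x y z ℓ)
  tripleWithCs-injective {x} {y} {z} {ℓ} ox oy oz x≢y x≢z y≢z {i} {j} = injective i j
    where
    injective : ∀ i j → tripleWithCs x y z ℓ i ≡ tripleWithCs x y z ℓ j → i ≡ j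
    injective zero                zero                _    = refl
    injective zero                (suc zero)          eq   = ⊥-elim (x≢y eq)
    injective zero                (suc (suc zero))    eq   = ⊥-elim (x≢z eq)
    injective zero                (suc (suc (suc _))) eq   = ⊥-elim (OnCycle⇒≢c ox eq)
    injective (suc zero)          zero                eq   = ⊥-elim (x≢y (sym eq))
    injective (suc zero)          (suc zero)          _    = refl
    injective (suc zero)          (suc (suc zero))    eq   = ⊥-elim (y≢z eq)
    injective (suc zero)          (suc (suc (suc _))) eq   = ⊥-elim (OnCycle⇒≢c oy eq)
    injective (suc (suc zero))    zero                eq   = ⊥-elim (x≢z (sym eq))
    injective (suc (suc zero))    (suc zero)          eq   = ⊥-elim (y≢z (sym eq))
    injective (suc (suc zero))    (suc (suc zero))    _    = refl
    injective (suc (suc zero))    (suc (suc (suc _))) eq   = ⊥-elim (OnCycle⇒≢c oz eq)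
    injective (suc (suc (suc _))) zero                eq   = ⊥-elim (OnCycle⇒≢c ox (sym eq))
    injective (suc (suc (suc _))) (suc zero)          eq   = ⊥-elim (OnCycle⇒≢c oy (sym eq))
    injective (suc (suc (suc _))) (suc (suc zero))    eq   = ⊥-elim (OnCycle⇒≢c oz (sym eq))
    injective (suc (suc (suc _))) (suc (suc (suc _))) refl = refl

  block : Fin γ → Fin t → V
  block ℓ = tripleWithCs (a (inject₁ ℓ)) (a (suc ℓ)) (b ℓ) ℓ

  block-injective : ∀ ℓ → Injective _≡_ _≡_ (block ℓ)
  block-injective ℓ = tripleWithCs-injective (cycle-a _) (cycle-a _) (cycle-b _)
    (a-≢ λ eq → 1+n≢n (sym (trans (sym (toℕ-inject₁ ℓ)) eq))) (λ ()) (λ ())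

  block-InK : ∀ ℓ i → InK ℓ (block ℓ i)
  block-InK ℓ zero                = inj₁ (toℕ-inject₁ ℓ)
  block-InK ℓ (suc zero)          = inj₂ refl
  block-InK ℓ (suc (suc zero))    = refl
  block-InK ℓ (suc (suc (suc _))) = refl

  -- Lower bound on the chromatic number

  -- Fewer than t colours repeat a colour on each K_ℓ, necessarily on an excluded pair; inductively
  -- b_ℓ and a_{ℓ+1} then share a colour for every ℓ, but in the last block they are adjacent.
  colourable⇒t≤ : ∀ {j} → Colourable E j → t ≤ j
  colourable⇒t≤ {j} (f , f-proper) = ≮⇒≥ λ j<t →
    <-irrefl (cong suc (toℕ-fromℕ g)) (proj₁ (clashChain j<t (fromℕ g)))
    where
    excludedClash : j < t → ∀ ℓ → (suc (toℕ ℓ) < γ × f (b ℓ) ≡ f (a (suc ℓ)))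
                                ⊎ (0 < toℕ ℓ × f (a (inject₁ ℓ)) ≡ f (b ℓ))
    excludedClash j<t ℓ with pigeonhole j<t (f ∘ block ℓ)
    ... | i , i′ , i<i′ , same with adjacent-or-excluded (block-InK ℓ i) (block-InK ℓ i′)
                                                         (<⇒≢ᶠ i<i′ ∘ block-injective ℓ)
    ...   | inj₁ e                 = ⊥-elim (f-proper _ _ e same)
    ...   | inj₂ (inj₁ (l , pair)) = inj₁ (l , IsPair-cong f pair same)
    ...   | inj₂ (inj₂ (l , pair)) = inj₂ (l , IsPair-cong f pair same)

    clashChain : j < t → ∀ ℓ → suc (toℕ ℓ) < γ × f (b ℓ) ≡ f (a (suc ℓ))
    clashChain j<t = <-weakInduction _ base step
      where
      base : suc 0 < γ × f (b zero) ≡ f (a (suc zero))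
      base with excludedClash j<t zero
      ... | inj₁ clash = clash
      ... | inj₂ (() , _)

      step : ∀ i → suc (toℕ (inject₁ i)) < γ × f (b (inject₁ i)) ≡ f (a (suc (inject₁ i))) →
             suc (toℕ (suc i)) < γ × f (b (suc i)) ≡ f (a (suc (suc i)))
      step i (_ , previous) with excludedClash j<t (suc i)
      ... | inj₁ clash      = clash
      ... | inj₂ (_ , same) = ⊥-elim (f-proper _ _ (b-chain-edge i) (trans previous same))

  -- Colouring H − v

  -- On the cycle a_i sits at position i and b_j at position 2γ − j. The vertex c_{j,k} is given the
  -- position of b_j: deleting it cuts the cycle there, and b_j takes over the colour reserved for c_{j,k}.
  posB : Fin γ → ℕ
  posB j = γ + (γ ∸ toℕ j)

  pos : V → ℕ
  pos (a i)   = toℕ i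
  pos (b j)   = posB j
  pos (c j _) = posB j

  toℕ≤γ : ∀ (i : Fin (suc γ)) → toℕ i ≤ γ
  toℕ≤γ i = s≤s⁻¹ (toℕ<n i)

  γ<posB : ∀ j → γ < posB j
  γ<posB j = m<m+n γ (m<n⇒0<n∸m (toℕ<n j))

  posB-injective : ∀ {j j′} → posB j ≡ posB j′ → j ≡ j′
  posB-injective {j} {j′} eq =
    toℕ-injective (∸-cancelˡ-≡ (<⇒≤ (toℕ<n j)) (<⇒≤ (toℕ<n j′)) (+-cancelˡ-≡ γ _ _ eq))

  posB-suc : ∀ {ℓ ℓ′} → toℕ ℓ′ ≡ suc (toℕ ℓ) → posB ℓ ≡ suc (posB ℓ′)
  posB-suc {ℓ} {ℓ′} ℓ′≡1+ℓ = begin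
    γ + (suc g ∸ toℕ ℓ)   ≡⟨ cong (γ +_) (+-∸-assoc 1 (s≤s⁻¹ (toℕ<n ℓ))) ⟩
    γ + suc (g ∸ toℕ ℓ)   ≡⟨ +-suc γ _ ⟩
    suc (γ + (g ∸ toℕ ℓ)) ≡⟨ cong (λ n → suc (γ + (γ ∸ n))) ℓ′≡1+ℓ ⟨
    suc (posB ℓ′)         ∎
    where open ≡-Reasoning

  posB-last : ∀ {ℓ} → toℕ ℓ ≡ g → posB ℓ ≡ suc γ
  posB-last ℓ≡g = trans (cong (λ n → γ + (γ ∸ n)) ℓ≡g) (trans (cong (γ +_) (m+n∸n≡m 1 g)) (+-comm γ 1))

  pos≤ : ∀ v → pos v ≤ γ + γ
  pos≤ (a i)   = ≤-trans (toℕ≤γ i) (m≤m+n γ γ)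
  pos≤ (b j)   = +-monoʳ-≤ γ (m∸n≤m γ (toℕ j))
  pos≤ (c j _) = +-monoʳ-≤ γ (m∸n≤m γ (toℕ j))

  cycleStep-ab : ∀ {x y} → E (a x) (b y) →
                 CycleStep γ (pos (a x)) (pos (b y)) ⊎ CycleStep γ (pos (b y)) (pos (a x))
  cycleStep-ab {x} (inj₁ (ℓ , inj₁ x≡ℓ , refl , _ , ¬ex)) =
    inj₂ (subst₂ (CycleStep γ) (sym (cong (λ n → γ + (γ ∸ n)) ℓ≡0)) (sym (trans x≡ℓ ℓ≡0)) wrap)
    where
    ℓ≡0 : toℕ ℓ ≡ 0
    ℓ≡0 with 0 <? toℕ ℓ
    ... | yes 0<ℓ =
      ⊥-elim (¬ex (inj₂ (0<ℓ , inj₁ (cong a (toℕ-injective (trans x≡ℓ (sym (toℕ-inject₁ ℓ)))) , refl))))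
    ... | no 0≮ℓ  = n≤0⇒n≡0 (≮⇒≥ 0≮ℓ)
  cycleStep-ab {x} (inj₁ (ℓ , inj₂ x≡1+ℓ , refl , _ , ¬ex)) =
    inj₁ (CycleStep-next (trans (posB-last ℓ≡g) (cong suc (sym (trans x≡1+ℓ (cong suc ℓ≡g))))))
    where
    ℓ≡g : toℕ ℓ ≡ g
    ℓ≡g with suc (toℕ ℓ) <? γ
    ... | yes 1+ℓ<γ = ⊥-elim (¬ex (inj₁ (1+ℓ<γ , inj₂ (cong a (toℕ-injective x≡1+ℓ) , refl))))
    ... | no 1+ℓ≮γ  = ≤-antisym (s≤s⁻¹ (toℕ<n ℓ)) (s≤s⁻¹ (≮⇒≥ 1+ℓ≮γ))
  cycleStep-ab (inj₂ (_ , _ , _ , inj₁ (() , _)))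
  cycleStep-ab (inj₂ (_ , _ , _ , inj₂ (() , _)))

  cycleStep : ∀ {u w} → OnCycle u → OnCycle w → E u w →
              CycleStep γ (pos u) (pos w) ⊎ CycleStep γ (pos w) (pos u)
  cycleStep (cycle-a x) (cycle-a y) (inj₁ (ℓ , inj₁ x≡ℓ , inj₁ y≡ℓ , x≢y , _)) =
    ⊥-elim (x≢y (cong a (toℕ-injective (trans x≡ℓ (sym y≡ℓ)))))
  cycleStep (cycle-a x) (cycle-a y) (inj₁ (ℓ , inj₁ x≡ℓ , inj₂ y≡1+ℓ , _)) =
    inj₁ (CycleStep-next (trans y≡1+ℓ (cong suc (sym x≡ℓ))))
  cycleStep (cycle-a x) (cycle-a y) (inj₁ (ℓ , inj₂ x≡1+ℓ , inj₁ y≡ℓ , _)) =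
    inj₂ (CycleStep-next (trans x≡1+ℓ (cong suc (sym y≡ℓ))))
  cycleStep (cycle-a x) (cycle-a y) (inj₁ (ℓ , inj₂ x≡1+ℓ , inj₂ y≡1+ℓ , x≢y , _)) =
    ⊥-elim (x≢y (cong a (toℕ-injective (trans x≡1+ℓ (sym y≡1+ℓ)))))
  cycleStep (cycle-a x) (cycle-a y) (inj₂ (_ , _ , _ , inj₁ (() , _)))
  cycleStep (cycle-a x) (cycle-a y) (inj₂ (_ , _ , _ , inj₂ (() , _)))
  cycleStep (cycle-b x) (cycle-b y) (inj₁ (_ , refl , refl , x≢y , _)) = ⊥-elim (x≢y refl)
  cycleStep (cycle-b x) (cycle-b y) (inj₂ (ℓ , ℓ′ , ℓ′≡1+ℓ , inj₁ (refl , refl))) =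
    inj₂ (CycleStep-next (posB-suc ℓ′≡1+ℓ))
  cycleStep (cycle-b x) (cycle-b y) (inj₂ (ℓ , ℓ′ , ℓ′≡1+ℓ , inj₂ (refl , refl))) =
    inj₁ (CycleStep-next (posB-suc ℓ′≡1+ℓ))
  cycleStep (cycle-a x) (cycle-b y) e = cycleStep-ab e
  cycleStep (cycle-b x) (cycle-a y) e = swap (cycleStep-ab (E-sym e))

  Colour : Set
  Colour = Fin (2 + s)

  bit : Bool → Colour
  bit true  = zero
  bit false = suc zero

  reserved : Fin s → Colour
  reserved k = suc (suc k)

  bit-injective : ∀ {x y} → bit x ≡ bit y → x ≡ y
  bit-injective {true}  {true}  _ = refl
  bit-injective {false} {false} _ = refl

  bit≢reserved : ∀ {x k} → bit x ≢ reserved k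
  bit≢reserved {true}  ()
  bit≢reserved {false} ()

  reserved-injective : ∀ {k k′} → reserved k ≡ reserved k′ → k ≡ k′
  reserved-injective refl = refl

  colourB : V → Fin γ → Colour
  colourB (a i)   j = bit (cutParity (toℕ i) (posB j))
  colourB (b ℓ)   j = bit (cutParity (posB ℓ) (posB j))
  colourB (c ℓ k) j with ℓ ≟ᶠ j
  ... | yes _ = reserved k
  ... | no _  = bit (cutParity (posB ℓ) (posB j))

  colour : V → V → Colour
  colour v (a i)   = bit (cutParity (pos v) (toℕ i))
  colour v (b j)   = colourB v j
  colour v (c _ k) = reserved k

  data CycleColour (v u : V) : Colour → Set where
    byParity  : pos v ≢ pos u → CycleColour v u (bit (cutParity (pos v) (pos u)))
    inherited : ∀ {j k} → u ≡ b j → v ≡ c j k → CycleColour v u (reserved k)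

  cycleColour : ∀ v {u} → OnCycle u → u ≢ v → CycleColour v u (colour v u)
  cycleColour v       (cycle-a i) a≢v = byParity (λ eq → a≢v (sym (pos≡toℕ⇒a v eq)))
    where
    pos≡toℕ⇒a : ∀ v {i} → pos v ≡ toℕ i → v ≡ a i
    pos≡toℕ⇒a (a _)   eq = cong a (toℕ-injective eq)
    pos≡toℕ⇒a (b j)   eq = ⊥-elim (<⇒≢ (≤-<-trans (toℕ≤γ _) (γ<posB j)) (sym eq))
    pos≡toℕ⇒a (c j _) eq = ⊥-elim (<⇒≢ (≤-<-trans (toℕ≤γ _) (γ<posB j)) (sym eq))
  cycleColour (a i)   (cycle-b j) _   = byParity (<⇒≢ (≤-<-trans (toℕ≤γ i) (γ<posB j)))
  cycleColour (b ℓ)   (cycle-b j) b≢v = byParity (λ eq → b≢v (cong b (sym (posB-injective eq))))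
  cycleColour (c ℓ k) (cycle-b j) _ with ℓ ≟ᶠ j
  ... | yes refl = inherited refl refl
  ... | no ℓ≢j   = byParity (ℓ≢j ∘ posB-injective)

  colour-properOnCycle : ∀ v {u w} → OnCycle u → OnCycle w → u ≢ v → w ≢ v → E u w →
                         colour v u ≢ colour v w
  colour-properOnCycle v {u} {w} ou ow u≢v w≢v e
    with colour v u | cycleColour v ou u≢v | colour v w | cycleColour v ow w≢v
  ... | _ | byParity v≢u        | _ | byParity v≢w        =
    cutParity-proper (pos≤ v) v≢u v≢w (cycleStep ou ow e) ∘ bit-injective
  ... | _ | byParity _          | _ | inherited _ _       = bit≢reserved
  ... | _ | inherited _ _       | _ | byParity _          = bit≢reserved ∘ sym
  ... | _ | inherited refl refl | _ | inherited refl refl = λ _ → E-irrefl e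

  b-c-edge : ∀ {x j k} → E (b x) (c j k) → x ≡ j
  b-c-edge (inj₁ (_ , refl , refl , _))           = refl
  b-c-edge (inj₂ (_ , _ , _ , inj₁ (_ , ())))
  b-c-edge (inj₂ (_ , _ , _ , inj₂ (_ , ())))

  c-c-edge : ∀ {j k j′ k′} → E (c j k) (c j′ k′) → j ≡ j′
  c-c-edge (inj₁ (_ , refl , refl , _))           = refl
  c-c-edge (inj₂ (_ , _ , _ , inj₁ (() , _)))
  c-c-edge (inj₂ (_ , _ , _ , inj₂ (() , _)))

  colour-b-c : ∀ v {j k} → b j ≢ v → c j k ≢ v → colour v (b j) ≢ reserved k
  colour-b-c v {j} b≢v c≢v with colour v (b j) | cycleColour v (cycle-b j) b≢v
  ... | _ | byParity _          = bit≢reserved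
  ... | _ | inherited refl refl = λ eq → c≢v (cong (c j) (sym (reserved-injective eq)))

  colour-proper : ∀ v u w → u ≢ v → w ≢ v → E u w → colour v u ≢ colour v w
  colour-proper v (a x)   (a y)     = colour-properOnCycle v (cycle-a x) (cycle-a y)
  colour-proper v (a x)   (b y)     = colour-properOnCycle v (cycle-a x) (cycle-b y)
  colour-proper v (b x)   (a y)     = colour-properOnCycle v (cycle-b x) (cycle-a y)
  colour-proper v (b x)   (b y)     = colour-properOnCycle v (cycle-b x) (cycle-b y)
  colour-proper v (a _)   (c _ _) _ _ _ = bit≢reserved
  colour-proper v (c _ _) (a _)   _ _ _ = bit≢reserved ∘ sym
  colour-proper v (b x)   (c j k) b≢v c≢v e with b-c-edge e
  ... | refl = colour-b-c v b≢v c≢v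
  colour-proper v (c j k) (b x)   c≢v b≢v e with b-c-edge (E-sym e)
  ... | refl = colour-b-c v b≢v c≢v ∘ sym
  colour-proper v (c j k) (c j′ k′) _ _ e eq with c-c-edge e | reserved-injective eq
  ... | refl | refl = E-irrefl e

  DelVertex-colourable : ∀ v → Colourable (DelVertex E v) (2 + s)
  DelVertex-colourable v = colour v ∘ proj₁ , λ (u , u≢v) (w , w≢v) → colour-proper v u w u≢v w≢v

  critical : Critical E t
  critical = (extendColouring _≟_ E-irrefl (a zero) (DelVertex-colourable (a zero)) , λ _ → colourable⇒t≤)
           , λ v → DelVertex-colourable v , λ _ → s≤s⁻¹ ∘ colourable⇒t≤ ∘ extendColouring _≟_ E-irrefl v

  -- Closed neighbourhoods and the treewidth lower bound

  a-injective : ∀ {i i′ : Fin (suc γ)} → _≡_ {A = V} (a i) (a i′) → i ≡ i′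
  a-injective refl = refl

  pos-≢ : ∀ {u w} → pos u ≢ pos w → u ≢ w
  pos-≢ pos-u≢pos-w = pos-u≢pos-w ∘ cong pos

  closedNeighbour : ∀ {ℓ v w} → InK ℓ v → InK ℓ w → ¬ Excluded {t} {γ} ℓ v w → w ≡ v ⊎ E v w
  closedNeighbour {ℓ} {v} {w} iv iw ¬ex with w ≟ v
  ... | yes w≡v = inj₁ w≡v
  ... | no w≢v  = inj₂ (inj₁ (ℓ , iv , iw , w≢v ∘ sym , ¬ex))

  blockNeighbours : ∀ {v} ℓ → InK ℓ v → (∀ w → ¬ Excluded {t} {γ} ℓ v w) → ClosedNeighbours E v t
  blockNeighbours ℓ iv ¬ex = record
    { member    = block ℓ
    ; injective = block-injective ℓ
    ; adjacent  = λ i → closedNeighbour iv (block-InK ℓ i) (¬ex _)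
    }

  tripleNeighbours : ∀ {v x y z} ℓ → InK ℓ v → OnCycle x → OnCycle y → OnCycle z → x ≢ y → x ≢ z → y ≢ z →
                     x ≡ v ⊎ E v x → y ≡ v ⊎ E v y → z ≡ v ⊎ E v z → ClosedNeighbours E v t
  tripleNeighbours ℓ iv ox oy oz x≢y x≢z y≢z nx ny nz = record
    { member    = tripleWithCs _ _ _ ℓ
    ; injective = tripleWithCs-injective ox oy oz x≢y x≢z y≢z
    ; adjacent  = λ { zero → nx ; (suc zero) → ny ; (suc (suc zero)) → nz
                    ; (suc (suc (suc _))) → closedNeighbour iv refl (¬Excluded-c ∘ Excluded-swap) }
    }

  bPred : Fin γ → V
  bPred zero    = a zero
  bPred (suc j) = b (inject₁ j)

  bSucc : Fin γ → V
  bSucc j with view j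
  ... | ‵fromℕ      = a (fromℕ γ)
  ... | ‵inject₁ j′ = b (suc j′)

  bPred-onCycle : ∀ j → OnCycle (bPred j)
  bPred-onCycle zero    = cycle-a _
  bPred-onCycle (suc _) = cycle-b _

  bSucc-onCycle : ∀ j → OnCycle (bSucc j)
  bSucc-onCycle j with view j
  ... | ‵fromℕ     = cycle-a _
  ... | ‵inject₁ _ = cycle-b _

  bPred-adjacent : ∀ j → E (b j) (bPred j)
  bPred-adjacent zero    = inj₁ (zero , refl , inj₁ refl , (λ ()) , λ
    { (inj₁ (_ , inj₁ (_ , ()))) ; (inj₁ (_ , inj₂ (() , _))) ; (inj₂ (() , _)) })
  bPred-adjacent (suc j) = E-sym (b-chain-edge j)

  bSucc-adjacent : ∀ j → E (b j) (bSucc j)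
  bSucc-adjacent j with view j
  ... | ‵inject₁ j′ = b-chain-edge j′
  ... | ‵fromℕ      = inj₁ (fromℕ g , refl , inj₂ refl , (λ ()) , λ
    { (inj₁ (1+ℓ<γ , _))        → <-irrefl (cong suc (toℕ-fromℕ g)) 1+ℓ<γ
    ; (inj₂ (_ , inj₁ (() , _)))
    ; (inj₂ (_ , inj₂ (_ , eq))) → fromℕ≢inject₁ (a-injective eq) })

  pos-bPred : ∀ j → pos (bPred j) ≡ suc (pos (b j)) ⊎ pos (bPred j) ≡ 0
  pos-bPred zero    = inj₂ refl
  pos-bPred (suc j) = inj₁ (posB-suc (cong suc (sym (toℕ-inject₁ j))))

  pos-bSucc : ∀ j → pos (b j) ≡ suc (pos (bSucc j))
  pos-bSucc j with view j
  ... | ‵fromℕ      = trans (posB-last (toℕ-fromℕ g)) (cong suc (sym (toℕ-fromℕ γ)))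
  ... | ‵inject₁ j′ = posB-suc (cong suc (sym (toℕ-inject₁ j′)))

  bNeighbours : ∀ j → ClosedNeighbours E (b j) t
  bNeighbours j = tripleNeighbours j refl (bPred-onCycle j) (cycle-b j) (bSucc-onCycle j)
    (pos-≢ bPred≢b) (pos-≢ bPred≢bSucc) (pos-≢ b≢bSucc)
    (inj₂ (bPred-adjacent j)) (inj₁ refl) (inj₂ (bSucc-adjacent j))
    where
    b≢bSucc : posB j ≢ pos (bSucc j)
    b≢bSucc eq = 1+n≢n (trans (sym (pos-bSucc j)) eq)

    bPred≢b : pos (bPred j) ≢ posB j
    bPred≢b with pos-bPred j
    ... | inj₁ bPred≡1+b = λ eq → 1+n≢n (trans (sym bPred≡1+b) eq)
    ... | inj₂ bPred≡0   = λ eq → <⇒≢ (≤-<-trans z≤n (γ<posB j)) (trans (sym bPred≡0) eq)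

    bPred≢bSucc : pos (bPred j) ≢ pos (bSucc j)
    bPred≢bSucc with pos-bPred j
    ... | inj₁ bPred≡1+b = λ eq → n≢2+n _ (trans (sym eq) (trans bPred≡1+b (cong suc (pos-bSucc j))))
    ... | inj₂ bPred≡0   = λ eq → case subst (γ <_) (trans (pos-bSucc j) (cong suc (trans (sym eq) bPred≡0)))
                                                  (γ<posB j) of λ { (s≤s ()) }

  closedNeighbours : ∀ v → ClosedNeighbours E v t
  closedNeighbours (c j k) = blockNeighbours j refl (λ _ → ¬Excluded-c)
  closedNeighbours (b j)   = bNeighbours j
  closedNeighbours (a i) with view i
  ... | ‵fromℕ = blockNeighbours (fromℕ g) (inj₂ refl) λ
    { _ (inj₁ (1+ℓ<γ , _))         → <-irrefl (cong suc (toℕ-fromℕ g)) 1+ℓ<γ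
    ; _ (inj₂ (_ , inj₁ (eq , _))) → fromℕ≢inject₁ (a-injective eq)
    ; _ (inj₂ (_ , inj₂ (() , _))) }
  ... | ‵inject₁ zero = blockNeighbours zero (inj₁ refl) λ
    { _ (inj₁ (_ , inj₁ (() , _))) ; _ (inj₁ (_ , inj₂ (() , _))) ; _ (inj₂ (() , _)) }
  ... | ‵inject₁ (suc ℓ) = tripleNeighbours (suc ℓ) (inj₁ (toℕ-inject₁ (suc ℓ)))
    (cycle-a _) (cycle-a _) (cycle-a (suc (suc ℓ)))
    (a-≢ λ eq → 1+n≢n (trans eq (toℕ-inject₁ (inject₁ ℓ))))
    (a-≢ λ eq → 1+n≢n (sym (trans (sym (toℕ-inject₁ ℓ)) (suc-injective eq))))
    (a-≢ λ eq → n≢2+n (toℕ ℓ) (trans (sym (trans (toℕ-inject₁ (inject₁ ℓ)) (toℕ-inject₁ ℓ))) eq))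
    (inj₁ refl)
    (closedNeighbour (inj₂ refl) (inj₁ (toℕ-inject₁ (inject₁ ℓ))) ¬Excluded-a-a)
    (closedNeighbour (inj₁ (toℕ-inject₁ (suc ℓ))) (inj₂ refl) ¬Excluded-a-a)

  treeDecomposition⇒2+s≤ : ∀ {w} → TreeDecomposition E w → 2 + s ≤ w
  treeDecomposition⇒2+s≤ = s≤s⁻¹ ∘ treeDecomposition-width-≥ vertexCount (a zero) closedNeighbours

  -- A path decomposition

  -- The bags are K_0, {a_1, b_0, b_1}, K_1, {a_2, b_1, b_2}, …, K_{γ−1}; v lies exactly in the
  -- bags n with Span v n.
  Span : V → ℕ → Set
  Span (a i)   n = toℕ i + toℕ i ≤ 2 + n × n ≤ toℕ i + toℕ i
  Span (b j)   n = toℕ j + toℕ j ≤ 1 + n × n ≤ 1 + (toℕ j + toℕ j)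
  Span (c j _) n = toℕ j + toℕ j ≤ n     × n ≤ toℕ j + toℕ j

  Span-convex : ∀ v {i j k} → Span v i → Span v k → i ≤ j → j ≤ k → Span v j
  Span-convex (a _)   (lo , _) (_ , hi) i≤j j≤k = ≤-trans lo (+-monoʳ-≤ 2 i≤j) , ≤-trans j≤k hi
  Span-convex (b _)   (lo , _) (_ , hi) i≤j j≤k = ≤-trans lo (+-monoʳ-≤ 1 i≤j) , ≤-trans j≤k hi
  Span-convex (c _ _) (lo , _) (_ , hi) i≤j j≤k = ≤-trans lo i≤j , ≤-trans j≤k hi

  blockBag : Fin γ → List V
  blockBag ℓ = map (block ℓ) (allFin t)

  linkBag : Fin γ → Fin γ → List V
  linkBag ℓ ℓ′ = a (suc ℓ) ∷ b ℓ ∷ b ℓ′ ∷ []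

  ∈blockBag⇒InK : ∀ {ℓ v} → v ∈ blockBag ℓ → InK ℓ v
  ∈blockBag⇒InK {ℓ} v∈ with ∈-map⁻ (block ℓ) {xs = allFin t} v∈
  ... | i , _ , refl = block-InK ℓ i

  InK⇒∈blockBag : ∀ {ℓ} v → InK ℓ v → v ∈ blockBag ℓ
  InK⇒∈blockBag {ℓ} (a i) (inj₁ i≡ℓ) =
    subst (_∈ blockBag ℓ) (cong a (toℕ-injective (trans (toℕ-inject₁ ℓ) (sym i≡ℓ))))
          (∈-map⁺ (block ℓ) (∈-allFin {t} zero))
  InK⇒∈blockBag {ℓ} (a i) (inj₂ i≡1+ℓ) =
    subst (_∈ blockBag ℓ) (cong a (toℕ-injective (sym i≡1+ℓ))) (∈-map⁺ (block ℓ) (∈-allFin {t} (suc zero)))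
  InK⇒∈blockBag {ℓ} (b _)   refl = ∈-map⁺ (block ℓ) (∈-allFin (suc (suc zero)))
  InK⇒∈blockBag {ℓ} (c _ k) refl = ∈-map⁺ (block ℓ) (∈-allFin (suc (suc (suc k))))

  InK⇒Span : ∀ {ℓ} v → InK ℓ v → Span v (toℕ ℓ + toℕ ℓ)
  InK⇒Span {ℓ} (a i) (inj₁ i≡ℓ) rewrite i≡ℓ = ≤-trans (n≤1+n _) (n≤1+n _) , ≤-refl
  InK⇒Span {ℓ} (a i) (inj₂ i≡1+ℓ) rewrite i≡1+ℓ =
    ≤-reflexive (double-suc _) , ≤-trans (≤-trans (n≤1+n _) (n≤1+n _)) (≤-reflexive (sym (double-suc _)))
  InK⇒Span (b _)   refl = n≤1+n _ , n≤1+n _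
  InK⇒Span (c _ _) refl = ≤-refl , ≤-refl

  Span⇒InK : ∀ {ℓ} v → Span v (toℕ ℓ + toℕ ℓ) → InK ℓ v
  Span⇒InK {ℓ} (a i) (i≤ , ℓ≤) with m≤n⇒m<n∨m≡n (double-≤-double⇒≤ ℓ≤)
  ... | inj₂ ℓ≡i = inj₁ (sym ℓ≡i)
  ... | inj₁ ℓ<i = inj₂ (≤-antisym (double-≤-double⇒≤ (≤-trans i≤ (≤-reflexive (sym (double-suc _))))) ℓ<i)
  Span⇒InK (b _)   (j≤ , ℓ≤) = toℕ-injective (≤-antisym (double-≤-suc-double⇒≤ j≤) (double-≤-suc-double⇒≤ ℓ≤))
  Span⇒InK (c _ _) (j≤ , ℓ≤) = toℕ-injective (≤-antisym (double-≤-double⇒≤ j≤) (double-≤-double⇒≤ ℓ≤))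

  ∈linkBag⇒Span : ∀ {ℓ ℓ′ v} → toℕ ℓ′ ≡ suc (toℕ ℓ) → v ∈ linkBag ℓ ℓ′ → Span v (suc (toℕ ℓ + toℕ ℓ))
  ∈linkBag⇒Span _ (here refl) =
    ≤-trans (≤-reflexive (double-suc _)) (n≤1+n _) , ≤-trans (n≤1+n _) (≤-reflexive (sym (double-suc _)))
  ∈linkBag⇒Span _ (there (here refl)) = ≤-trans (n≤1+n _) (n≤1+n _) , ≤-refl
  ∈linkBag⇒Span {ℓ} ℓ′≡1+ℓ (there (there (here refl))) rewrite ℓ′≡1+ℓ =
    ≤-reflexive (double-suc _) ,
    s≤s (≤-trans (≤-trans (n≤1+n _) (n≤1+n _)) (≤-reflexive (sym (double-suc _))))

  Span⇒∈linkBag : ∀ {ℓ ℓ′} v → toℕ ℓ′ ≡ suc (toℕ ℓ) → Span v (suc (toℕ ℓ + toℕ ℓ)) → v ∈ linkBag ℓ ℓ′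
  Span⇒∈linkBag {ℓ} (a i) _ (i≤ , ℓ≤) = here (cong a (toℕ-injective (≤-antisym
    (double-≤-suc-double⇒≤ (≤-trans i≤ (≤-reflexive (cong suc (sym (double-suc _))))))
    (suc-double≤double⇒< ℓ≤))))
  Span⇒∈linkBag {ℓ} (b j) ℓ′≡1+ℓ (j≤ , ℓ≤)
    with m≤n⇒m<n∨m≡n (double-≤-double⇒≤ (s≤s⁻¹ ℓ≤))
  ... | inj₂ ℓ≡j = there (here (cong b (toℕ-injective (sym ℓ≡j))))
  ... | inj₁ ℓ<j = there (there (here (cong b (toℕ-injective (trans (≤-antisym
        (double-≤-double⇒≤ (≤-trans j≤ (≤-reflexive (sym (double-suc _))))) ℓ<j) (sym ℓ′≡1+ℓ))))))
  Span⇒∈linkBag {ℓ} (c j _) _ (j≤ , ℓ≤) =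
    ⊥-elim (<-irrefl refl (<-≤-trans (suc-double≤double⇒< {toℕ j} {toℕ ℓ} ℓ≤) (double-≤-suc-double⇒≤ j≤)))

  toℕ-mod : ∀ {ℓ} → ℓ < γ → toℕ (ℓ mod γ) ≡ ℓ
  toℕ-mod ℓ<γ = trans (toℕ-fromℕ< _) (m<n⇒m%n≡m ℓ<γ)

  -- ℓ mod γ only converts indices ℓ < γ to Fin γ.
  bagOf : ∀ {n} → Parity n → List V
  bagOf (even ℓ) = blockBag (ℓ mod γ)
  bagOf (odd ℓ)  = linkBag (ℓ mod γ) (suc ℓ mod γ)

  bag : ℕ → List V
  bag n = bagOf (parity n)

  bag-length : ∀ n → length (bag n) ≤ t
  bag-length n with parity n
  ... | even ℓ = ≤-reflexive (trans (length-map _ (allFin t)) (length-tabulate id))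
  ... | odd ℓ  = s≤s (s≤s (s≤s z≤n))

  ∈bag⇔Span : ∀ {n} v → n ≤ g + g → (v ∈ bag n → Span v n) × (Span v n → v ∈ bag n)
  ∈bag⇔Span {n} v n≤ with parity n
  ... | even ℓ = (λ v∈ → subst (λ m → Span v (m + m)) ℓ̂≡ℓ (InK⇒Span v (∈blockBag⇒InK v∈)))
               , (λ span → InK⇒∈blockBag v (Span⇒InK v (subst (λ m → Span v (m + m)) (sym ℓ̂≡ℓ) span)))
    where
    ℓ̂≡ℓ : toℕ (ℓ mod γ) ≡ ℓ
    ℓ̂≡ℓ = toℕ-mod (s≤s (double-≤-double⇒≤ n≤))
  ... | odd ℓ = (λ v∈ → subst (λ m → Span v (suc (m + m))) ℓ̂≡ℓ (∈linkBag⇒Span consecutive v∈))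
              , (λ span → Span⇒∈linkBag v consecutive (subst (λ m → Span v (suc (m + m))) (sym ℓ̂≡ℓ) span))
    where
    ℓ<g : ℓ < g
    ℓ<g = suc-double≤double⇒< n≤
    ℓ̂≡ℓ : toℕ (ℓ mod γ) ≡ ℓ
    ℓ̂≡ℓ = toℕ-mod (m<n⇒m<1+n ℓ<g)
    consecutive : toℕ (suc ℓ mod γ) ≡ suc (toℕ (ℓ mod γ))
    consecutive = trans (toℕ-mod (s≤s ℓ<g)) (cong suc (sym ℓ̂≡ℓ))

  blockOf : ∀ v → ∃ λ (ℓ : Fin γ) → InK {t} ℓ v
  blockOf (a i) with view i
  ... | ‵fromℕ     = fromℕ g , inj₂ refl
  ... | ‵inject₁ ℓ = ℓ , inj₁ (toℕ-inject₁ ℓ)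
  blockOf (b j)   = j , refl
  blockOf (c j _) = j , refl

  double≤ : ∀ (ℓ : Fin γ) → toℕ ℓ + toℕ ℓ ≤ g + g
  double≤ ℓ = +-mono-≤ (s≤s⁻¹ (toℕ<n ℓ)) (s≤s⁻¹ (toℕ<n ℓ))

  bagIndex : ∀ {n} → n ≤ g + g → Fin (suc (g + g))
  bagIndex n≤ = fromℕ< (s≤s n≤)

  Span⇒∈bagIndex : ∀ {n v} (n≤ : n ≤ g + g) → Span v n → v ∈ bag (toℕ (bagIndex n≤))
  Span⇒∈bagIndex {n} {v} n≤ span =
    subst (λ m → v ∈ bag m) (sym (toℕ-fromℕ< (s≤s n≤))) (proj₂ (∈bag⇔Span v n≤) span)

  pathDecomposition : PathDecomposition E (2 + s)
  pathDecomposition = record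
    { m        = suc (g + g)
    ; bag      = bag ∘ toℕ
    ; width    = bag-length ∘ toℕ
    ; coverV   = coverV
    ; coverE   = coverE
    ; interval = λ v i j k i≤j j≤k v∈i v∈k → proj₂ (∈bag⇔Span v (bound j))
        (Span-convex v (proj₁ (∈bag⇔Span v (bound i)) v∈i) (proj₁ (∈bag⇔Span v (bound k)) v∈k) i≤j j≤k)
    }
    where
    bound : ∀ (i : Fin (suc (g + g))) → toℕ i ≤ g + g
    bound i = s≤s⁻¹ (toℕ<n i)

    coverV : ∀ v → ∃ λ i → v ∈ bag (toℕ i)
    coverV v with blockOf v
    ... | ℓ , iv = bagIndex (double≤ ℓ) , Span⇒∈bagIndex (double≤ ℓ) (InK⇒Span v iv)

    coverE : ∀ u w → E u w → ∃ λ i → u ∈ bag (toℕ i) × w ∈ bag (toℕ i)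
    coverE u w (inj₁ (ℓ , iu , iw , _)) =
      bagIndex (double≤ ℓ) ,
      Span⇒∈bagIndex (double≤ ℓ) (InK⇒Span u iu) , Span⇒∈bagIndex (double≤ ℓ) (InK⇒Span w iw)
    coverE u w (inj₂ (ℓ , ℓ′ , ℓ′≡1+ℓ , pair)) =
      bagIndex n≤ , IsPair-both (λ v → v ∈ bag (toℕ (bagIndex n≤))) pair
        (Span⇒∈bagIndex n≤ (∈linkBag⇒Span ℓ′≡1+ℓ (there (here refl))))
        (Span⇒∈bagIndex n≤ (∈linkBag⇒Span ℓ′≡1+ℓ (there (there (here refl)))))
      where
      n≤ : suc (toℕ ℓ + toℕ ℓ) ≤ g + g
      n≤ = ≤-trans (≤-trans (n≤1+n _) (≤-reflexive (sym (double-suc _))))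
                   (subst (λ m → m + m ≤ g + g) ℓ′≡1+ℓ (double≤ ℓ′))

  pathwidth : Pathwidth E (2 + s)
  pathwidth = pathDecomposition , λ _ → treeDecomposition⇒2+s≤ ∘ pathDecomposition⇒treeDecomposition (a zero)

  treewidth : Treewidth E (2 + s)
  treewidth = pathDecomposition⇒treeDecomposition (a zero) pathDecomposition , λ _ → treeDecomposition⇒2+s≤

lemma6p5 : (t γ : ℕ) → 3 ≤ t → 1 ≤ γ →
    (HVertex t γ ↔ Fin ((t ∸ 1) * γ + 1))
    × Critical (HAdj t γ) t
    × Pathwidth (HAdj t γ) (t ∸ 1)
    × Treewidth (HAdj t γ) (t ∸ 1)
lemma6p5 (suc (suc (suc s))) (suc g) _ _ = vertexCount , critical , pathwidth , treewidth
  where open H s g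
lemma6p5 (suc (suc (suc _))) zero _ ()
lemma6p5 (suc (suc zero))    _ (s≤s (s≤s ())) _
lemma6p5 (suc zero)          _ (s≤s ()) _
lemma6p5 zero                _ () _
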